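{- Let $p$ be a prime and $d \ge 1$ an integer. Consider all $p^{d+1}$ tuples $(a_0,a_1,\dots,a_d)\in \mathbb{F}_p^{d+1}$ and the associated polynomials $F(x)=a_0x^d+a_1x^{d-1}+\cdots+a_{d-1}x+a_d\in\mathbb{F}_p[x]$. Let $M_d(p)$ denote the number of such tuples for which $F$ has no zero in $\mathbb{F}_p$, and let $D_d(p)=M_d(p)/p^{d+1}$. Then $$D_d(p)=\Big(1-\frac1p\Big)\sum_{k=0}^{\min(d,p-1)}(-1)^k\binom{p-1}{k}p^{ -k}.$$ In particular, if $p\le d+1$, then $D_d(p)=\big(1-\frac1p\big)^p$.
   Context: In the paper, $D_d(p)$ is interpreted as the probability that $p$ is not a "periodic prime divisor" of a random degree-$d$ polynomial $P$ with integer coefficients, when the coefficients of $P$ modulo $p$ are taken uniformly distributed in $\mathbb{F}_p^{d+1}$. A prime $p$ is a periodic prime divisor of $P$ if for every $m\in\mathbb{Z}$, $p$ divides at least one of $P(m),P(m+1),\dots,P(m+p-1)$; for integer-coefficient $P$ this holds exactly when $P$ has a root modulo $p$. -}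

module Defs where

open import Data.Nat as ℕ using (ℕ; zero; suc; _⊓_; _∸_; NonZero)
open import Data.Nat.Properties using (m^n≢0)
open import Data.Nat.Divisibility using (_∣_; _∣?_)
open import Data.Nat.Primality using (Prime; prime⇒nonZero)
open import Data.Nat.Combinatorics using (_C_)
open import Data.Fin using (Fin; toℕ)
open import Data.Fin.Properties using (any?)
open import Data.Vec using (Vec; []; _∷_; foldl)
open import Data.List using (List; []; _∷_; length; filter; map; concatMap; allFin; upTo; foldr)
open import Data.Product using (∃; _,_)
open import Relation.Nullary using (Dec; ¬_; ¬?)
open import Data.Integer as ℤ using (ℤ; +_; -[1+_])
open import Data.Rational as ℚ using (ℚ; _/_; 0ℚ; 1ℚ)

-- The prime field F_p is modelled by its canonical residues Fin p = {0,…,p-1};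
-- an element x is zero in F_p iff p divides its natural-number representative.

tuples : (p n : ℕ) → List (Vec (Fin p) n)
tuples p zero    = [] ∷ []
tuples p (suc n) = concatMap (λ a → map (a ∷_) (tuples p n)) (allFin p)

-- Value (as a natural number, before reduction mod p) of
-- F(x) = a_0 x^d + a_1 x^{d-1} + … + a_d  at x, via Horner's scheme.
eval : {p n : ℕ} → Vec (Fin p) n → ℕ → ℕ
eval {p} as x = foldl (λ _ → ℕ) (λ acc a → acc ℕ.* x ℕ.+ toℕ a) 0 as

HasZero : {p n : ℕ} → Vec (Fin p) n → Set
HasZero {p} as = ∃ λ (x : Fin p) → p ∣ eval as (toℕ x)

hasZero? : {p n : ℕ} → (as : Vec (Fin p) n) → Dec (HasZero as)
hasZero? {p} as = any? (λ x → p ∣? eval as (toℕ x))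

M : (d p : ℕ) → ℕ
M d p = length (filter (λ as → ¬? (hasZero? as)) (tuples p (suc d)))

D : (d p : ℕ) → Prime p → ℚ
D d p pr = (+ M d p) / (p ℕ.^ suc d)
  where instance
    nzp : NonZero p
    nzp = prime⇒nonZero pr
    nzpow : NonZero (p ℕ.^ suc d)
    nzpow = m^n≢0 p (suc d)

RHS : (d p : ℕ) → Prime p → ℚ
RHS d p pr =
  (1ℚ ℚ.- (+ 1) / p) ℚ.*
  foldr ℚ._+_ 0ℚ
    (map (λ k → _/_ ((ℤ.- (+ 1)) ℤ.^ k ℤ.* (+ ((p ∸ 1) C k))) (p ℕ.^ k) {{m^n≢0 p k}})
         (upTo (suc (d ⊓ (p ∸ 1)))))
  where instance
    nzp : NonZero p
    nzp = prime⇒nonZero pr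

_^ℚ_ : ℚ → ℕ → ℚ
q ^ℚ zero  = 1ℚ
q ^ℚ suc n = q ℚ.* (q ^ℚ n)

RHS' : (p : ℕ) → Prime p → ℚ
RHS' p pr = (1ℚ ℚ.- (+ 1) / p) ^ℚ p
  where instance
    nzp : NonZero p
    nzp = prime⇒nonZero pr

module Submission where

-- A tuple v ∈ F_p^n is read (in Horner order) as a polynomial of degree < n.
-- For a list A of distinct points of F_p let N n A count the tuples whose
-- polynomial has no zero on A.  Then N n [] = p^n, N 0 (x ∷ A) = 0 (the empty
-- tuple is the zero polynomial), and for x ∉ A the deletion rule
--     N (n+1) (x ∷ A) + N n A = N (n+1) A
-- holds, because the polynomials of degree ≤ n vanishing at x are exactly the
-- (X - x)·g with deg g < n, and (X - x)·g has the zeros of g away from x.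
-- The map (g, r) ↦ (X - x)·g + r is a triangular change of coefficients that
-- translates one coordinate at a time modulo p, so it preserves sums over
-- F_p^(n+1); this replaces an explicit bijection.
-- Dividing by p^n turns the deletion rule into a recursion for the proportion
-- H a n = N n A / p^n (a = |A|); Pascal's rule solves it in closed form,
--     H (a+1) (n+1) = (1 - 1/p) Σ_{k≤n} (-1)^k C(a,k) p^(-k),
-- and the sum stabilises for n ≥ a at (1 - 1/p)^a.  As M_d(p) = N (d+1) F_p,
-- the theorem is the case a = p of these two formulas.

open import Defs
open import Data.Nat using (ℕ; _≤_; _+_)
open import Data.Nat.Primality using (Prime)
open import Data.Product using (_×_)
open import Relation.Binary.PropositionalEquality using (_≡_)

open import Data.Nat as ℕ using (zero; suc; _*_; _∸_; _^_; _%_; _<_; _⊓_; NonZero; z≤n; s≤s; ≢-nonZero⁻¹)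
open import Data.Nat.Properties
open import Data.Nat.DivMod using (_mod_; %-distribˡ-+; %-distribˡ-*; m%n%n≡m%n; m<n⇒m%n≡m; n%n≡0; %-remove-+ˡ; %-remove-+ʳ)
open import Data.Nat.Divisibility using (_∣_; _∣?_; _∣0; ∣-refl; m∣m*n; ∣n⇒∣m*n; n∣m⇒m%n≡0; m%n≡0⇒n∣m)
open import Data.Nat.Primality using (prime⇒nonZero; euclidsLemma)
open import Data.Nat.Combinatorics using (_C_; nCk+nC[k+1]≡[n+1]C[k+1]; k>n⇒nCk≡0)
open import Data.Nat.Tactic.RingSolver using (solve-∀)
open import Data.Fin as Fin using (Fin; toℕ)
open import Data.Fin.Properties using (toℕ-injective; toℕ<n; toℕ-fromℕ<)
open import Data.Vec using (Vec; []; _∷_; foldl; _∷ʳ_)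
open import Data.List using (List; []; _∷_; length; filter; map; concatMap; allFin; tabulate; applyUpTo; foldr; _++_)
open import Data.List.Properties using (length-tabulate)
open import Data.List.Membership.Propositional using (_∈_)
open import Data.List.Membership.Propositional.Properties using (∈-allFin)
open import Data.List.Relation.Unary.Any using (here; there)
open import Data.List.Relation.Unary.All as All using (All; []; _∷_)
open import Data.List.Relation.Unary.AllPairs using ([]; _∷_)
open import Data.List.Relation.Unary.Unique.Propositional using (Unique)
open import Data.List.Relation.Unary.Unique.Propositional.Properties using (allFin⁺)
import Data.Integer as ℤ
import Data.Integer.Properties as ℤP
open import Data.Integer.Tactic.RingSolver using () renaming (solve-∀ to ℤ-solve-∀)
open import Data.Rational as ℚ using (ℚ; _/_; 0ℚ; 1ℚ; toℚᵘ)
import Data.Rational.Properties as ℚP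
open import Data.Rational.Unnormalised as ℚᵘ using (mkℚᵘ; *≡*)
import Data.Rational.Unnormalised.Properties as ℚᵘP
open import Data.Rational.Solver using (module +-*-Solver)
open import Data.Empty using (⊥-elim)
open import Data.Sum using (inj₁; inj₂)
open import Data.Product using (_,_)
open import Relation.Nullary using (Dec; yes; no; ¬_; ¬?)
open import Relation.Binary.PropositionalEquality using (refl; sym; trans; cong; cong₂; subst; _≢_; module ≡-Reasoning)
open import Function using (_∘_; id)

∑ : {A : Set} → List A → (A → ℕ) → ℕ
∑ []       f = 0
∑ (x ∷ xs) f = f x + ∑ xs f

∑-cong : {A : Set} (xs : List A) {f g : A → ℕ} → (∀ x → f x ≡ g x) → ∑ xs f ≡ ∑ xs g
∑-cong []       f≗g = refl
∑-cong (x ∷ xs) f≗g = cong₂ _+_ (f≗g x) (∑-cong xs f≗g)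

∑-+ : {A : Set} (xs : List A) (f g : A → ℕ) → ∑ xs (λ x → f x + g x) ≡ ∑ xs f + ∑ xs g
∑-+ []       f g = refl
∑-+ (x ∷ xs) f g rewrite ∑-+ xs f g = interchange (f x) (g x) (∑ xs f) (∑ xs g)
  where
  interchange : ∀ a b c d → a + b + (c + d) ≡ a + c + (b + d)
  interchange = solve-∀

∑-++ : {A : Set} (xs ys : List A) (f : A → ℕ) → ∑ (xs ++ ys) f ≡ ∑ xs f + ∑ ys f
∑-++ []       ys f = refl
∑-++ (x ∷ xs) ys f rewrite ∑-++ xs ys f = sym (+-assoc (f x) (∑ xs f) (∑ ys f))

∑-map : {A B : Set} (xs : List A) (h : A → B) (f : B → ℕ) → ∑ (map h xs) f ≡ ∑ xs (f ∘ h)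
∑-map []       h f = refl
∑-map (x ∷ xs) h f = cong (f (h x) +_) (∑-map xs h f)

∑-concatMap : {A B : Set} (xs : List A) (h : A → List B) (f : B → ℕ) →
              ∑ (concatMap h xs) f ≡ ∑ xs (λ a → ∑ (h a) f)
∑-concatMap []       h f = refl
∑-concatMap (x ∷ xs) h f =
  trans (∑-++ (h x) (concatMap h xs) f) (cong (∑ (h x) f +_) (∑-concatMap xs h f))

∑Fin : (m : ℕ) → (Fin m → ℕ) → ℕ
∑Fin zero    g = 0
∑Fin (suc m) g = g Fin.zero + ∑Fin m (g ∘ Fin.suc)

∑Fin-cong : (m : ℕ) {f g : Fin m → ℕ} → (∀ a → f a ≡ g a) → ∑Fin m f ≡ ∑Fin m g
∑Fin-cong zero    f≗g = refl
∑Fin-cong (suc m) f≗g = cong₂ _+_ (f≗g Fin.zero) (∑Fin-cong m (f≗g ∘ Fin.suc))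

∑Fin-const : (m c : ℕ) → ∑Fin m (λ _ → c) ≡ m * c
∑Fin-const zero    c = refl
∑Fin-const (suc m) c = cong (c +_) (∑Fin-const m c)

∑-tabulate : (m : ℕ) {B : Set} (h : Fin m → B) (f : B → ℕ) → ∑ (tabulate h) f ≡ ∑Fin m (f ∘ h)
∑-tabulate zero    h f = refl
∑-tabulate (suc m) h f = cong (f (h Fin.zero) +_) (∑-tabulate m (h ∘ Fin.suc) f)

∑< : ℕ → (ℕ → ℕ) → ℕ
∑< zero    K = 0
∑< (suc m) K = K 0 + ∑< m (K ∘ suc)

∑<-cong : (m : ℕ) {K L : ℕ → ℕ} → (∀ i → K i ≡ L i) → ∑< m K ≡ ∑< m L
∑<-cong zero    K≗L = refl
∑<-cong (suc m) K≗L = cong₂ _+_ (K≗L 0) (∑<-cong m (K≗L ∘ suc))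

∑<-snoc : (m : ℕ) (K : ℕ → ℕ) → ∑< (suc m) K ≡ ∑< m K + K m
∑<-snoc zero    K = +-comm (K 0) 0
∑<-snoc (suc m) K rewrite ∑<-snoc m (K ∘ suc) = sym (+-assoc (K 0) (∑< m (K ∘ suc)) (K (suc m)))

∑Fin≡∑< : (m : ℕ) (g : Fin m → ℕ) (K : ℕ → ℕ) → (∀ a → g a ≡ K (toℕ a)) → ∑Fin m g ≡ ∑< m K
∑Fin≡∑< zero    g K g≗K = refl
∑Fin≡∑< (suc m) g K g≗K = cong₂ _+_ (g≗K Fin.zero) (∑Fin≡∑< m (g ∘ Fin.suc) (K ∘ suc) (g≗K ∘ Fin.suc))

𝟙 : {P : Set} → Dec P → ℕ
𝟙 (yes _) = 1
𝟙 (no _)  = 0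

𝟙-yes : {P : Set} → P → (P? : Dec P) → 𝟙 P? ≡ 1
𝟙-yes p (yes _) = refl
𝟙-yes p (no ¬p) = ⊥-elim (¬p p)

𝟙-no : {P : Set} → ¬ P → (P? : Dec P) → 𝟙 P? ≡ 0
𝟙-no ¬p (yes p) = ⊥-elim (¬p p)
𝟙-no ¬p (no _)  = refl

𝟙-cong : {P Q : Set} → (P → Q) → (Q → P) → (P? : Dec P) (Q? : Dec Q) → 𝟙 P? ≡ 𝟙 Q?
𝟙-cong P→Q Q→P (yes p) Q? = sym (𝟙-yes (P→Q p) Q?)
𝟙-cong P→Q Q→P (no ¬p) Q? = sym (𝟙-no (¬p ∘ Q→P) Q?)

𝟙-complement : {P : Set} (P? : Dec P) → 𝟙 (¬? P?) + 𝟙 P? ≡ 1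
𝟙-complement (yes _) = refl
𝟙-complement (no _)  = refl

length-filter≡∑𝟙 : {A : Set} {P : A → Set} (P? : (x : A) → Dec (P x)) (xs : List A) →
                   length (filter P? xs) ≡ ∑ xs (λ x → 𝟙 (P? x))
length-filter≡∑𝟙 P? [] = refl
length-filter≡∑𝟙 P? (x ∷ xs) with P? x
... | yes _ = cong suc (length-filter≡∑𝟙 P? xs)
... | no _  = length-filter≡∑𝟙 P? xs

∏ : {A : Set} → List A → (A → ℕ) → ℕ
∏ []       f = 1
∏ (x ∷ xs) f = f x * ∏ xs f

∏-congAll : {A : Set} (xs : List A) {f g : A → ℕ} → All (λ x → f x ≡ g x) xs → ∏ xs f ≡ ∏ xs g
∏-congAll []       []           = refl
∏-congAll (x ∷ xs) (fx≡gx ∷ eq) = cong₂ _*_ fx≡gx (∏-congAll xs eq)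

∏-ones : {A : Set} (xs : List A) {f : A → ℕ} → (∀ x → f x ≡ 1) → ∏ xs f ≡ 1
∏-ones []       f≡1 = refl
∏-ones (x ∷ xs) f≡1 rewrite f≡1 x | ∏-ones xs f≡1 = refl

∏-zero : {A : Set} {xs : List A} {f : A → ℕ} {x : A} → x ∈ xs → f x ≡ 0 → ∏ xs f ≡ 0
∏-zero {xs = y ∷ xs} (here refl) fx≡0 rewrite fx≡0 = refl
∏-zero {xs = y ∷ xs} {f} (there x∈xs) fx≡0 rewrite ∏-zero {xs = xs} {f} x∈xs fx≡0 = *-zeroʳ (f y)

∑Tuple : (p n : ℕ) → (Vec (Fin p) n → ℕ) → ℕ
∑Tuple p n f = ∑ (tuples p n) f

∑Tuple-cong : (p n : ℕ) {f g : Vec (Fin p) n → ℕ} → (∀ v → f v ≡ g v) → ∑Tuple p n f ≡ ∑Tuple p n g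
∑Tuple-cong p n = ∑-cong (tuples p n)

∑Tuple-cons : (p n : ℕ) (f : Vec (Fin p) (suc n) → ℕ) →
              ∑Tuple p (suc n) f ≡ ∑Fin p (λ a → ∑Tuple p n (f ∘ (a ∷_)))
∑Tuple-cons p n f = begin
  ∑ (concatMap (λ a → map (a ∷_) (tuples p n)) (allFin p)) f
    ≡⟨ ∑-concatMap (allFin p) (λ a → map (a ∷_) (tuples p n)) f ⟩
  ∑ (allFin p) (λ a → ∑ (map (a ∷_) (tuples p n)) f)
    ≡⟨ ∑-cong (allFin p) (λ a → ∑-map (tuples p n) (a ∷_) f) ⟩
  ∑ (allFin p) (λ a → ∑Tuple p n (f ∘ (a ∷_)))
    ≡⟨ ∑-tabulate p id _ ⟩
  ∑Fin p (λ a → ∑Tuple p n (f ∘ (a ∷_))) ∎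
  where open ≡-Reasoning

∑Tuple-snoc : (p n : ℕ) (f : Vec (Fin p) (suc n) → ℕ) →
              ∑Tuple p (suc n) f ≡ ∑Tuple p n (λ g → ∑Fin p (λ r → f (g ∷ʳ r)))
∑Tuple-snoc p zero f =
  trans (∑Tuple-cons p zero f) (trans (∑Fin-cong p (λ a → +-identityʳ _)) (sym (+-identityʳ _)))
∑Tuple-snoc p (suc n) f =
  trans (∑Tuple-cons p (suc n) f)
    (trans (∑Fin-cong p (λ a → ∑Tuple-snoc p n (f ∘ (a ∷_))))
      (sym (∑Tuple-cons p n (λ g → ∑Fin p (λ r → f (g ∷ʳ r))))))

∑Tuple-one : (p n : ℕ) → ∑Tuple p n (λ _ → 1) ≡ p ^ n
∑Tuple-one p zero    = refl
∑Tuple-one p (suc n) =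
  trans (∑Tuple-cons p n (λ _ → 1)) (trans (∑Fin-cong p (λ _ → ∑Tuple-one p n)) (∑Fin-const p (p ^ n)))

module Residues (m : ℕ) where

  p : ℕ
  p = suc m

  infix 4 _≡ₚ_
  _≡ₚ_ : ℕ → ℕ → Set
  a ≡ₚ b = a % p ≡ b % p

  ≡ₚ-+ : ∀ {a a′ b b′} → a ≡ₚ a′ → b ≡ₚ b′ → a + b ≡ₚ a′ + b′
  ≡ₚ-+ {a} {a′} {b} {b′} a≡a′ b≡b′ =
    trans (%-distribˡ-+ a b p) (trans (cong₂ (λ u v → (u + v) % p) a≡a′ b≡b′) (sym (%-distribˡ-+ a′ b′ p)))

  ≡ₚ-* : ∀ {a a′ b b′} → a ≡ₚ a′ → b ≡ₚ b′ → a * b ≡ₚ a′ * b′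
  ≡ₚ-* {a} {a′} {b} {b′} a≡a′ b≡b′ =
    trans (%-distribˡ-* a b p) (trans (cong₂ (λ u v → (u * v) % p) a≡a′ b≡b′) (sym (%-distribˡ-* a′ b′ p)))

  ∣-resp-≡ₚ : ∀ {a b} → a ≡ₚ b → p ∣ a → p ∣ b
  ∣-resp-≡ₚ {a} {b} a≡b p∣a = m%n≡0⇒n∣m b p (trans (sym a≡b) (n∣m⇒m%n≡0 a p p∣a))

  toℕ-mod : ∀ x → toℕ (x mod p) ≡ x % p
  toℕ-mod x = toℕ-fromℕ< _

  mod-≡ₚ : ∀ x → toℕ (x mod p) ≡ₚ x
  mod-≡ₚ x = trans (cong (_% p) (toℕ-mod x)) (m%n%n≡m%n x p)

  mod-toℕ : (a : Fin p) → toℕ a mod p ≡ a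
  mod-toℕ a = toℕ-injective (trans (toℕ-mod (toℕ a)) (m<n⇒m%n≡m (toℕ<n a)))

  Periodic : (ℕ → ℕ) → Set
  Periodic K = ∀ i → K (i % p) ≡ K i

  ∑<-rotate : (K : ℕ → ℕ) → Periodic K → ∑< p (K ∘ suc) ≡ ∑< p K
  ∑<-rotate K periodic = begin
    ∑< p (K ∘ suc)          ≡⟨ ∑<-snoc m (K ∘ suc) ⟩
    ∑< m (K ∘ suc) + K p    ≡⟨ cong (∑< m (K ∘ suc) +_) (trans (sym (periodic p)) (cong K (n%n≡0 p))) ⟩
    ∑< m (K ∘ suc) + K 0    ≡⟨ +-comm _ (K 0) ⟩
    ∑< p K                  ∎
    where open ≡-Reasoning

  ∑<-translate : ∀ s (K : ℕ → ℕ) → Periodic K → ∑< p (λ i → K (i + s)) ≡ ∑< p K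
  ∑<-translate zero    K periodic = ∑<-cong p (λ i → cong K (+-identityʳ i))
  ∑<-translate (suc s) K periodic = begin
    ∑< p (λ i → K (i + suc s)) ≡⟨ ∑<-cong p (λ i → cong K (+-suc i s)) ⟩
    ∑< p (K′ ∘ suc)            ≡⟨ ∑<-rotate K′ periodic′ ⟩
    ∑< p K′                    ≡⟨ ∑<-translate s K periodic ⟩
    ∑< p K                     ∎
    where
    open ≡-Reasoning
    K′ : ℕ → ℕ
    K′ i = K (i + s)
    periodic′ : Periodic K′
    periodic′ i = trans (sym (periodic (i % p + s))) (trans (cong K i%p+s≡ₚi+s) (periodic (i + s)))
      where
      i%p+s≡ₚi+s : (i % p + s) % p ≡ (i + s) % p
      i%p+s≡ₚi+s = ≡ₚ-+ {i % p} {i} {s} {s} (m%n%n≡m%n i p) refl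

  ∑Fin-translate : ∀ s (k : Fin p → ℕ) → ∑Fin p (λ a → k ((toℕ a + s) mod p)) ≡ ∑Fin p k
  ∑Fin-translate s k = begin
    ∑Fin p (λ a → k ((toℕ a + s) mod p)) ≡⟨ ∑Fin≡∑< p _ (λ i → K (i + s)) (λ a → refl) ⟩
    ∑< p (λ i → K (i + s))               ≡⟨ ∑<-translate s K periodic ⟩
    ∑< p K                               ≡⟨ ∑Fin≡∑< p k K (λ a → cong k (sym (mod-toℕ a))) ⟨
    ∑Fin p k                             ∎
    where
    open ≡-Reasoning
    K : ℕ → ℕ
    K i = k (i mod p)
    periodic : Periodic K
    periodic i = cong k (toℕ-injective (trans (toℕ-mod (i % p)) (trans (m%n%n≡m%n i p) (sym (toℕ-mod i)))))

  -- Synthetic multiplication: mulXPlus s 0 (g ∷ʳ r) is the coefficient tuple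
  -- (Horner order) of (X + s)·g + r, reduced mod p.  The carry c is the
  -- previous coefficient of g.
  mulXPlus : ∀ {n} → ℕ → ℕ → Vec (Fin p) n → Vec (Fin p) n
  mulXPlus s c []       = []
  mulXPlus s c (a ∷ as) = ((toℕ a + s * c) mod p) ∷ mulXPlus s (toℕ a) as

  -- Each output coefficient is a translate of the corresponding input
  -- coefficient, by an amount depending only on earlier inputs; hence
  -- mulXPlus permutes F_p^n and preserves sums over it.
  ∑Tuple-mulXPlus : ∀ n s c (f : Vec (Fin p) n → ℕ) → ∑Tuple p n (f ∘ mulXPlus s c) ≡ ∑Tuple p n f
  ∑Tuple-mulXPlus zero    s c f = refl
  ∑Tuple-mulXPlus (suc n) s c f = begin
    ∑Tuple p (suc n) (f ∘ mulXPlus s c)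
      ≡⟨ ∑Tuple-cons p n _ ⟩
    ∑Fin p (λ a → ∑Tuple p n (λ v → f (shifted a ∷ mulXPlus s (toℕ a) v)))
      ≡⟨ ∑Fin-cong p (λ a → ∑Tuple-mulXPlus n s (toℕ a) (λ v → f (shifted a ∷ v))) ⟩
    ∑Fin p (λ a → ∑Tuple p n (λ v → f (shifted a ∷ v)))
      ≡⟨ ∑Fin-translate (s * c) (λ a → ∑Tuple p n (λ v → f (a ∷ v))) ⟩
    ∑Fin p (λ a → ∑Tuple p n (λ v → f (a ∷ v)))
      ≡⟨ ∑Tuple-cons p n f ⟨
    ∑Tuple p (suc n) f ∎
    where
    open ≡-Reasoning
    shifted : Fin p → Fin p
    shifted a = (toℕ a + s * c) mod p

  horner : ∀ {n} → ℕ → Vec (Fin p) n → ℕ → ℕ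
  horner acc as x = foldl (λ _ → ℕ) (λ acc a → acc * x + toℕ a) acc as

  -- One step of synthetic multiplication: if the accumulator F of the product
  -- is (x + s)·G + c, where G is the accumulator of g and c its pending
  -- coefficient, then after reading the next coefficient a of g the same
  -- relation holds for G·x + c and pending coefficient a.
  mulXPlus-step : ∀ s F G c a x → F ≡ₚ (x + s) * G + c →
                  F * x + toℕ ((a + s * c) mod p) ≡ₚ (x + s) * (G * x + c) + a
  mulXPlus-step s F G c a x inv =
    trans (≡ₚ-+ {F * x} {((x + s) * G + c) * x} (≡ₚ-* {F} {(x + s) * G + c} {x} {x} inv refl) (mod-≡ₚ (a + s * c)))
          (cong (_% p) (expand x s G c a))
    where
    expand : ∀ x s G c a → ((x + s) * G + c) * x + (a + s * c) ≡ (x + s) * (G * x + c) + a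
    expand = solve-∀

  horner-mulXPlus : ∀ s {k} (g : Vec (Fin p) k) r F G c x → F ≡ₚ (x + s) * G + c →
                    horner F (mulXPlus s c (g ∷ʳ r)) x ≡ₚ (x + s) * horner (G * x + c) g x + toℕ r
  horner-mulXPlus s []      r F G c x inv = mulXPlus-step s F G c (toℕ r) x inv
  horner-mulXPlus s (a ∷ g) r F G c x inv =
    horner-mulXPlus s g r _ (G * x + c) (toℕ a) x (mulXPlus-step s F G c (toℕ a) x inv)

  eval-mulXPlus : ∀ s {k} (g : Vec (Fin p) k) r x →
                  eval (mulXPlus s 0 (g ∷ʳ r)) x ≡ₚ (x + s) * eval g x + toℕ r
  eval-mulXPlus s g r x = horner-mulXPlus s g r 0 0 0 x (cong (_% p) (sym (trans (+-identityʳ _) (*-zeroʳ (x + s)))))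

module Counting (m : ℕ) (pr : Prime (suc m)) where

  open Residues m

  isRoot nonRoot : ∀ {n} → Vec (Fin p) n → Fin p → ℕ
  isRoot  v x = 𝟙 (p ∣? eval v (toℕ x))
  nonRoot v x = 𝟙 (¬? (p ∣? eval v (toℕ x)))

  N : ℕ → List (Fin p) → ℕ
  N n A = ∑Tuple p n (λ v → ∏ A (nonRoot v))

  N-[] : ∀ n → N n [] ≡ p ^ n
  N-[] n = ∑Tuple-one p n

  -- The empty tuple is the zero polynomial, which vanishes everywhere.
  N-zero : ∀ x A → N 0 (x ∷ A) ≡ 0
  N-zero x A = cong (λ k → k * ∏ A (nonRoot []) + 0) (𝟙-no (λ ¬p∣0 → ¬p∣0 (p ∣0)) (¬? (p ∣? 0)))

  noZero-indicator : ∀ {n} (v : Vec (Fin p) n) (Z? : Dec (HasZero v)) → 𝟙 (¬? Z?) ≡ ∏ (allFin p) (nonRoot v)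
  noZero-indicator v (yes (x , p∣vx)) =
    sym (∏-zero {f = nonRoot v} (∈-allFin x) (𝟙-no (λ ¬p∣vx → ¬p∣vx p∣vx) (¬? (p ∣? eval v (toℕ x)))))
  noZero-indicator v (no ¬zero) =
    sym (∏-ones (allFin p) (λ x → 𝟙-yes (λ p∣vx → ¬zero (x , p∣vx)) (¬? (p ∣? eval v (toℕ x)))))

  M≡N : ∀ d → M d p ≡ N (suc d) (allFin p)
  M≡N d = trans (length-filter≡∑𝟙 (λ v → ¬? (hasZero? v)) (tuples p (suc d)))
                (∑Tuple-cong p (suc d) (λ v → noZero-indicator v (hasZero? v)))

  -- Multiplication by X - x, written X + s with s = p - x, as a change of
  -- coefficients (g, r) ↦ (X + s)·g + r.
  module AtPoint (x : Fin p) where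

    s : ℕ
    s = p ∸ toℕ x

    x+s≡p : toℕ x + s ≡ p
    x+s≡p = m+[n∸m]≡n (<⇒≤ (toℕ<n x))

    eval-at-x : ∀ {k} (g : Vec (Fin p) k) r → eval (mulXPlus s 0 (g ∷ʳ r)) (toℕ x) ≡ₚ toℕ r
    eval-at-x g r = trans (eval-mulXPlus s g r (toℕ x))
      (trans (cong (λ u → (u * eval g (toℕ x) + toℕ r) % p) x+s≡p)
             (%-remove-+ˡ (toℕ r) (m∣m*n (eval g (toℕ x)))))

    isRoot-x-zero : ∀ {k} (g : Vec (Fin p) k) → isRoot (mulXPlus s 0 (g ∷ʳ Fin.zero)) x ≡ 1
    isRoot-x-zero g = 𝟙-yes (∣-resp-≡ₚ (sym (eval-at-x g Fin.zero)) (p ∣0)) _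

    isRoot-x-suc : ∀ {k} (g : Vec (Fin p) k) r → isRoot (mulXPlus s 0 (g ∷ʳ Fin.suc r)) x ≡ 0
    isRoot-x-suc g r = 𝟙-no p∤r _
      where
      p∤r : ¬ p ∣ eval (mulXPlus s 0 (g ∷ʳ Fin.suc r)) (toℕ x)
      p∤r p∣ = 0≢1+n (sym (trans (sym (m<n⇒m%n≡m (toℕ<n (Fin.suc r))))
                                 (n∣m⇒m%n≡0 (suc (toℕ r)) p (∣-resp-≡ₚ {b = suc (toℕ r)} (eval-at-x g (Fin.suc r)) p∣))))

    p∤c+s : ∀ c → c ≢ x → ¬ p ∣ toℕ c + s
    p∤c+s c c≢x p∣c+s = c≢x (toℕ-injective (sym (begin
      toℕ x                      ≡⟨ m<n⇒m%n≡m (toℕ<n x) ⟨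
      toℕ x % p                  ≡⟨ %-remove-+ʳ (toℕ x) p∣c+s ⟨
      (toℕ x + (toℕ c + s)) % p  ≡⟨ cong (_% p) rearrange ⟩
      (toℕ c + p) % p            ≡⟨ %-remove-+ʳ (toℕ c) (∣-refl {p}) ⟩
      toℕ c % p                  ≡⟨ m<n⇒m%n≡m (toℕ<n c) ⟩
      toℕ c                      ∎)))
      where
      open ≡-Reasoning
      rearrange : toℕ x + (toℕ c + s) ≡ toℕ c + p
      rearrange = trans (x+[y+z]≡y+[x+z] (toℕ x) (toℕ c) s) (cong (toℕ c +_) x+s≡p)
        where
        x+[y+z]≡y+[x+z] : ∀ a b c → a + (b + c) ≡ b + (a + c)
        x+[y+z]≡y+[x+z] = solve-∀

    nonRoot-away : ∀ {k} (g : Vec (Fin p) k) c → c ≢ x → nonRoot (mulXPlus s 0 (g ∷ʳ Fin.zero)) c ≡ nonRoot g c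
    nonRoot-away g c c≢x = 𝟙-cong (_∘ from) (_∘ to) _ _
      where
      product : eval (mulXPlus s 0 (g ∷ʳ Fin.zero)) (toℕ c) ≡ₚ (toℕ c + s) * eval g (toℕ c)
      product = trans (eval-mulXPlus s g Fin.zero (toℕ c)) (cong (_% p) (+-identityʳ ((toℕ c + s) * eval g (toℕ c))))
      to : p ∣ eval (mulXPlus s 0 (g ∷ʳ Fin.zero)) (toℕ c) → p ∣ eval g (toℕ c)
      to p∣ with euclidsLemma (toℕ c + s) (eval g (toℕ c)) pr (∣-resp-≡ₚ product p∣)
      ... | inj₁ p∣c+s = ⊥-elim (p∤c+s c c≢x p∣c+s)
      ... | inj₂ p∣g   = p∣g
      from : p ∣ eval g (toℕ c) → p ∣ eval (mulXPlus s 0 (g ∷ʳ Fin.zero)) (toℕ c)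
      from p∣g = ∣-resp-≡ₚ (sym product) (∣n⇒∣m*n (toℕ c + s) p∣g)

  -- Polynomials of degree ≤ n with a root at x and no zero on A (x ∉ A)
  -- correspond to the polynomials of degree < n with no zero on A: write them
  -- as (X - x)·g + r, then only r = 0 contributes.
  ∑-rootAt : ∀ n x A → All (x ≢_) A → ∑Tuple p (suc n) (λ v → isRoot v x * ∏ A (nonRoot v)) ≡ N n A
  ∑-rootAt n x A x∉A = begin
    ∑Tuple p (suc n) F                                     ≡⟨ ∑Tuple-mulXPlus (suc n) s 0 F ⟨
    ∑Tuple p (suc n) (F ∘ mulXPlus s 0)                    ≡⟨ ∑Tuple-snoc p n _ ⟩
    ∑Tuple p n (λ g → ∑Fin p (λ r → F (mulXPlus s 0 (g ∷ʳ r)))) ≡⟨ ∑Tuple-cong p n only-r≡0 ⟩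
    N n A                                                  ∎
    where
    open ≡-Reasoning
    open AtPoint x
    F : Vec (Fin p) (suc n) → ℕ
    F v = isRoot v x * ∏ A (nonRoot v)
    only-r≡0 : ∀ g → ∑Fin p (λ r → F (mulXPlus s 0 (g ∷ʳ r))) ≡ ∏ A (nonRoot g)
    only-r≡0 g = begin
      F (h Fin.zero) + ∑Fin m (λ r → F (h (Fin.suc r))) ≡⟨ cong₂ _+_ r≡0-term r≢0-terms ⟩
      ∏ A (nonRoot g) + 0                                ≡⟨ +-identityʳ _ ⟩
      ∏ A (nonRoot g)                                    ∎
      where
      h : Fin p → Vec (Fin p) (suc n)
      h r = mulXPlus s 0 (g ∷ʳ r)
      r≡0-term : F (h Fin.zero) ≡ ∏ A (nonRoot g)
      r≡0-term = begin
        isRoot (h Fin.zero) x * ∏ A (nonRoot (h Fin.zero)) ≡⟨ cong (_* ∏ A (nonRoot (h Fin.zero))) (isRoot-x-zero g) ⟩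
        1 * ∏ A (nonRoot (h Fin.zero))                      ≡⟨ *-identityˡ _ ⟩
        ∏ A (nonRoot (h Fin.zero))                          ≡⟨ ∏-congAll A (All.map (λ {c} x≢c → nonRoot-away g c (x≢c ∘ sym)) x∉A) ⟩
        ∏ A (nonRoot g)                                     ∎
      r≢0-terms : ∑Fin m (λ r → F (h (Fin.suc r))) ≡ 0
      r≢0-terms = trans (∑Fin-cong m {g = λ _ → 0} (λ r → cong (_* ∏ A (nonRoot (h (Fin.suc r)))) (isRoot-x-suc g r)))
                        (trans (∑Fin-const m 0) (*-zeroʳ m))

  N-delete : ∀ n x A → All (x ≢_) A → N (suc n) (x ∷ A) + N n A ≡ N (suc n) A
  N-delete n x A x∉A = begin
    N (suc n) (x ∷ A) + N n A
      ≡⟨ cong (N (suc n) (x ∷ A) +_) (∑-rootAt n x A x∉A) ⟨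
    ∑Tuple p (suc n) (λ v → nonRoot v x * Π v) + ∑Tuple p (suc n) (λ v → isRoot v x * Π v)
      ≡⟨ ∑-+ (tuples p (suc n)) _ _ ⟨
    ∑Tuple p (suc n) (λ v → nonRoot v x * Π v + isRoot v x * Π v)
      ≡⟨ ∑Tuple-cong p (suc n) split ⟩
    N (suc n) A ∎
    where
    open ≡-Reasoning
    Π : Vec (Fin p) (suc n) → ℕ
    Π v = ∏ A (nonRoot v)
    split : ∀ v → nonRoot v x * Π v + isRoot v x * Π v ≡ Π v
    split v = trans (sym (*-distribʳ-+ (Π v) (nonRoot v x) (isRoot v x)))
                    (trans (cong (_* Π v) (𝟙-complement (p ∣? eval v (toℕ x)))) (*-identityˡ (Π v)))

-- The embedding i ↦ i / 1 of ℤ into ℚ respects + and ·, and i / n = i · (1/n).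
-- Each is checked on unnormalised rationals, where i / (suc n) is mkℚᵘ i n.
toℚᵘ-/ : ∀ i n → toℚᵘ (i / suc n) ℚᵘ.≃ mkℚᵘ i n
toℚᵘ-/ i n = ℚP.toℚᵘ-fromℚᵘ (mkℚᵘ i n)

/1-+ : ∀ i j → (i ℤ.+ j) / 1 ≡ i / 1 ℚ.+ j / 1
/1-+ i j = ℚP.toℚᵘ-injective (begin
  toℚᵘ ((i ℤ.+ j) / 1)           ≈⟨ toℚᵘ-/ (i ℤ.+ j) 0 ⟩
  mkℚᵘ (i ℤ.+ j) 0               ≈⟨ *≡* (cross-multiply i j) ⟩
  mkℚᵘ i 0 ℚᵘ.+ mkℚᵘ j 0         ≈⟨ ℚᵘP.+-cong (ℚᵘP.≃-sym (toℚᵘ-/ i 0)) (ℚᵘP.≃-sym (toℚᵘ-/ j 0)) ⟩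
  toℚᵘ (i / 1) ℚᵘ.+ toℚᵘ (j / 1) ≈⟨ ℚP.toℚᵘ-homo-+ (i / 1) (j / 1) ⟨
  toℚᵘ (i / 1 ℚ.+ j / 1)         ∎)
  where
  open ℚᵘP.≃-Reasoning
  cross-multiply : ∀ i j → (i ℤ.+ j) ℤ.* (ℤ.+ 1) ≡ (i ℤ.* (ℤ.+ 1) ℤ.+ j ℤ.* (ℤ.+ 1)) ℤ.* (ℤ.+ 1)
  cross-multiply = ℤ-solve-∀

/1-* : ∀ i j → (i ℤ.* j) / 1 ≡ (i / 1) ℚ.* (j / 1)
/1-* i j = ℚP.toℚᵘ-injective (begin
  toℚᵘ ((i ℤ.* j) / 1)           ≈⟨ toℚᵘ-/ (i ℤ.* j) 0 ⟩
  mkℚᵘ i 0 ℚᵘ.* mkℚᵘ j 0         ≈⟨ ℚᵘP.*-cong (ℚᵘP.≃-sym (toℚᵘ-/ i 0)) (ℚᵘP.≃-sym (toℚᵘ-/ j 0)) ⟩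
  toℚᵘ (i / 1) ℚᵘ.* toℚᵘ (j / 1) ≈⟨ ℚP.toℚᵘ-homo-* (i / 1) (j / 1) ⟨
  toℚᵘ ((i / 1) ℚ.* (j / 1))     ∎)
  where open ℚᵘP.≃-Reasoning

/-as-* : ∀ i n .{{_ : NonZero n}} → i / n ≡ (i / 1) ℚ.* (ℤ.+ 1 / n)
/-as-* i (suc n) = ℚP.toℚᵘ-injective (begin
  toℚᵘ (i / suc n)                         ≈⟨ toℚᵘ-/ i n ⟩
  mkℚᵘ i n                                 ≈⟨ *≡* cross-multiply ⟩
  mkℚᵘ i 0 ℚᵘ.* mkℚᵘ (ℤ.+ 1) n             ≈⟨ ℚᵘP.*-cong (ℚᵘP.≃-sym (toℚᵘ-/ i 0)) (ℚᵘP.≃-sym (toℚᵘ-/ (ℤ.+ 1) n)) ⟩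
  toℚᵘ (i / 1) ℚᵘ.* toℚᵘ (ℤ.+ 1 / suc n)   ≈⟨ ℚP.toℚᵘ-homo-* (i / 1) (ℤ.+ 1 / suc n) ⟨
  toℚᵘ ((i / 1) ℚ.* (ℤ.+ 1 / suc n))       ∎)
  where
  open ℚᵘP.≃-Reasoning
  cross-multiply : i ℤ.* ℤ.+ suc (n + 0) ≡ (i ℤ.* ℤ.+ 1) ℤ.* ℤ.+ suc n
  cross-multiply rewrite +-identityʳ n | ℤP.*-identityʳ i = refl

1/-* : ∀ a b .{{_ : NonZero a}} .{{_ : NonZero b}} .{{_ : NonZero (a * b)}} →
       ℤ.+ 1 / (a * b) ≡ (ℤ.+ 1 / a) ℚ.* (ℤ.+ 1 / b)
1/-* (suc a) (suc b) = ℚP.toℚᵘ-injective (begin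
  toℚᵘ (ℤ.+ 1 / (suc a * suc b))                   ≈⟨ toℚᵘ-/ (ℤ.+ 1) _ ⟩
  mkℚᵘ (ℤ.+ 1) a ℚᵘ.* mkℚᵘ (ℤ.+ 1) b               ≈⟨ ℚᵘP.*-cong (ℚᵘP.≃-sym (toℚᵘ-/ (ℤ.+ 1) a)) (ℚᵘP.≃-sym (toℚᵘ-/ (ℤ.+ 1) b)) ⟩
  toℚᵘ (ℤ.+ 1 / suc a) ℚᵘ.* toℚᵘ (ℤ.+ 1 / suc b)   ≈⟨ ℚP.toℚᵘ-homo-* (ℤ.+ 1 / suc a) (ℤ.+ 1 / suc b) ⟨
  toℚᵘ ((ℤ.+ 1 / suc a) ℚ.* (ℤ.+ 1 / suc b))       ∎)
  where open ℚᵘP.≃-Reasoning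

n*1/n≡1 : ∀ n .{{_ : NonZero n}} → (ℤ.+ n / 1) ℚ.* (ℤ.+ 1 / n) ≡ 1ℚ
n*1/n≡1 (suc n) = trans (sym (/-as-* (ℤ.+ suc n) (suc n))) (ℚP.toℚᵘ-injective (begin
  toℚᵘ (ℤ.+ suc n / suc n) ≈⟨ toℚᵘ-/ (ℤ.+ suc n) n ⟩
  mkℚᵘ (ℤ.+ suc n) n       ≈⟨ *≡* (ℤP.*-comm (ℤ.+ suc n) (ℤ.+ 1)) ⟩
  toℚᵘ 1ℚ                  ∎))
  where open ℚᵘP.≃-Reasoning

∑ℚ : (ℕ → ℚ) → ℕ → ℚ
∑ℚ f zero    = 0ℚ
∑ℚ f (suc n) = f 0 ℚ.+ ∑ℚ (f ∘ suc) n

∑ℚ-cong : ∀ n {f g : ℕ → ℚ} → (∀ k → f k ≡ g k) → ∑ℚ f n ≡ ∑ℚ g n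
∑ℚ-cong zero    f≗g = refl
∑ℚ-cong (suc n) f≗g = cong₂ ℚ._+_ (f≗g 0) (∑ℚ-cong n (f≗g ∘ suc))

∑ℚ-linear : ∀ n (f g : ℕ → ℚ) c → ∑ℚ (λ k → f k ℚ.- c ℚ.* g k) n ≡ ∑ℚ f n ℚ.- c ℚ.* ∑ℚ g n
∑ℚ-linear zero    f g c = solve 1 (λ c → con 0ℚ := con 0ℚ :- c :* con 0ℚ) refl c
  where open +-*-Solver
∑ℚ-linear (suc n) f g c rewrite ∑ℚ-linear n (f ∘ suc) (g ∘ suc) c =
  regroup (f 0) (g 0) c (∑ℚ (f ∘ suc) n) (∑ℚ (g ∘ suc) n)
  where
  open +-*-Solver
  regroup : ∀ a b c d e → (a ℚ.- c ℚ.* b) ℚ.+ (d ℚ.- c ℚ.* e) ≡ (a ℚ.+ d) ℚ.- c ℚ.* (b ℚ.+ e)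
  regroup = solve 5 (λ a b c d e → (a :- c :* b) :+ (d :- c :* e) := (a :+ d) :- c :* (b :+ e)) refl

∑ℚ-zeros : ∀ n (f : ℕ → ℚ) → (∀ k → f k ≡ 0ℚ) → ∑ℚ f n ≡ 0ℚ
∑ℚ-zeros zero    f f≡0 = refl
∑ℚ-zeros (suc n) f f≡0 rewrite f≡0 0 | ∑ℚ-zeros n (f ∘ suc) (f≡0 ∘ suc) = refl

∑ℚ-tail : ∀ c e (f : ℕ → ℚ) → (∀ k → f (c + k) ≡ 0ℚ) → ∑ℚ f (c + e) ≡ ∑ℚ f c
∑ℚ-tail zero    e f tail≡0 = ∑ℚ-zeros e f tail≡0
∑ℚ-tail (suc c) e f tail≡0 = cong (f 0 ℚ.+_) (∑ℚ-tail c e (f ∘ suc) tail≡0)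

foldr-applyUpTo : ∀ n (f : ℕ → ℚ) (g : ℕ → ℕ) → foldr ℚ._+_ 0ℚ (map f (applyUpTo g n)) ≡ ∑ℚ (f ∘ g) n
foldr-applyUpTo zero    f g = refl
foldr-applyUpTo (suc n) f g = cong (f (g 0) ℚ.+_) (foldr-applyUpTo n f (g ∘ suc))

module Density (m : ℕ) where

  p : ℕ
  p = suc m

  q : ℚ
  q = ℤ.+ 1 / p

  1/p^≡q^ : ∀ j → _/_ (ℤ.+ 1) (p ^ j) {{m^n≢0 p j}} ≡ q ^ℚ j
  1/p^≡q^ zero    = refl
  1/p^≡q^ (suc j) = trans (1/-* p (p ^ j) {{_}} {{m^n≢0 p j}} {{m^n≢0 p (suc j)}}) (cong (q ℚ.*_) (1/p^≡q^ j))

  -- H a n: the proportion of polynomials of degree < n with no zero at a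
  -- prescribed points, defined by the recursion that the deletion rule
  -- imposes (H (a+1) 0 = 0 since the zero polynomial vanishes everywhere).
  H : ℕ → ℕ → ℚ
  H zero    n       = 1ℚ
  H (suc a) zero    = 0ℚ
  H (suc a) (suc n) = H a (suc n) ℚ.- q ℚ.* H a n

  -- t a k = (-1)^k C(a,k) / p^k, the summand of the right-hand side for a = p - 1.
  t : ℕ → ℕ → ℚ
  t a k = _/_ ((ℤ.- ℤ.+ 1) ℤ.^ k ℤ.* ℤ.+ (a C k)) (p ^ k) {{m^n≢0 p k}}

  T : ℕ → ℕ → ℚ
  T a n = ∑ℚ (t a) n

  sign : ℕ → ℚ
  sign k = (ℤ.- ℤ.+ 1) ℤ.^ k / 1

  binom : ℕ → ℕ → ℚ
  binom a k = ℤ.+ (a C k) / 1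

  t-factor : ∀ a k → t a k ≡ sign k ℚ.* binom a k ℚ.* q ^ℚ k
  t-factor a k = trans (/-as-* ((ℤ.- ℤ.+ 1) ℤ.^ k ℤ.* ℤ.+ (a C k)) (p ^ k) {{m^n≢0 p k}})
                       (cong₂ ℚ._*_ (/1-* ((ℤ.- ℤ.+ 1) ℤ.^ k) (ℤ.+ (a C k))) (1/p^≡q^ k))

  sign-suc : ∀ k → sign (suc k) ≡ ℚ.- 1ℚ ℚ.* sign k
  sign-suc k = /1-* (ℤ.- ℤ.+ 1) ((ℤ.- ℤ.+ 1) ℤ.^ k)

  binom-pascal : ∀ a k → binom (suc a) (suc k) ≡ binom a k ℚ.+ binom a (suc k)
  binom-pascal a k = trans (cong (λ c → ℤ.+ c / 1) (sym (nCk+nC[k+1]≡[n+1]C[k+1] a k)))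
                           (/1-+ (ℤ.+ (a C k)) (ℤ.+ (a C suc k)))

  t-pascal : ∀ a j → t (suc a) (suc j) ≡ t a (suc j) ℚ.- q ℚ.* t a j
  t-pascal a j = begin
    t (suc a) (suc j)
      ≡⟨ t-factor (suc a) (suc j) ⟩
    sign (suc j) ℚ.* binom (suc a) (suc j) ℚ.* q ^ℚ suc j
      ≡⟨ cong₂ (λ σ β → σ ℚ.* β ℚ.* q ^ℚ suc j) (sign-suc j) (binom-pascal a j) ⟩
    (ℚ.- 1ℚ ℚ.* sign j) ℚ.* (binom a j ℚ.+ binom a (suc j)) ℚ.* (q ℚ.* q ^ℚ j)
      ≡⟨ distribute (sign j) (binom a j) (binom a (suc j)) q (q ^ℚ j) ⟩
    (ℚ.- 1ℚ ℚ.* sign j) ℚ.* binom a (suc j) ℚ.* q ^ℚ suc j ℚ.- q ℚ.* (sign j ℚ.* binom a j ℚ.* q ^ℚ j)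
      ≡⟨ cong₂ (λ u v → u ℚ.- q ℚ.* v) (trans (t-factor a (suc j)) (cong (λ σ → σ ℚ.* binom a (suc j) ℚ.* q ^ℚ suc j) (sign-suc j)))
                                      (t-factor a j) ⟨
    t a (suc j) ℚ.- q ℚ.* t a j ∎
    where
    open ≡-Reasoning
    open +-*-Solver
    distribute : ∀ s c₀ c₁ q Q → (ℚ.- 1ℚ ℚ.* s) ℚ.* (c₀ ℚ.+ c₁) ℚ.* (q ℚ.* Q)
                                 ≡ (ℚ.- 1ℚ ℚ.* s) ℚ.* c₁ ℚ.* (q ℚ.* Q) ℚ.- q ℚ.* (s ℚ.* c₀ ℚ.* Q)
    distribute = solve 5 (λ s c₀ c₁ q Q → (:- con 1ℚ :* s) :* (c₀ :+ c₁) :* (q :* Q)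
                                          := (:- con 1ℚ :* s) :* c₁ :* (q :* Q) :- q :* (s :* c₀ :* Q)) refl

  t-vanish : ∀ a k → a < k → t a k ≡ 0ℚ
  t-vanish a k a<k = begin
    t a k                             ≡⟨ t-factor a k ⟩
    sign k ℚ.* binom a k ℚ.* q ^ℚ k   ≡⟨ cong (λ c → sign k ℚ.* (ℤ.+ c / 1) ℚ.* q ^ℚ k) (k>n⇒nCk≡0 a<k) ⟩
    sign k ℚ.* 0ℚ ℚ.* q ^ℚ k          ≡⟨ annihilate (sign k) (q ^ℚ k) ⟩
    0ℚ                                ∎
    where
    open ≡-Reasoning
    open +-*-Solver
    annihilate : ∀ s Q → s ℚ.* 0ℚ ℚ.* Q ≡ 0ℚ
    annihilate = solve 2 (λ s Q → s :* con 0ℚ :* Q := con 0ℚ) refl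

  T-pascal : ∀ a n → T (suc a) (suc n) ≡ T a (suc n) ℚ.- q ℚ.* T a n
  T-pascal a n = begin
    1ℚ ℚ.+ ∑ℚ (t (suc a) ∘ suc) n                 ≡⟨ cong (1ℚ ℚ.+_) (∑ℚ-cong n (t-pascal a)) ⟩
    1ℚ ℚ.+ ∑ℚ (λ j → t a (suc j) ℚ.- q ℚ.* t a j) n ≡⟨ cong (1ℚ ℚ.+_) (∑ℚ-linear n (t a ∘ suc) (t a) q) ⟩
    1ℚ ℚ.+ (∑ℚ (t a ∘ suc) n ℚ.- q ℚ.* T a n)      ≡⟨ reassociate (∑ℚ (t a ∘ suc) n) q (T a n) ⟩
    T a (suc n) ℚ.- q ℚ.* T a n                   ∎
    where
    open ≡-Reasoning
    open +-*-Solver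
    reassociate : ∀ x y z → 1ℚ ℚ.+ (x ℚ.- y ℚ.* z) ≡ (1ℚ ℚ.+ x) ℚ.- y ℚ.* z
    reassociate = solve 3 (λ x y z → con 1ℚ :+ (x :- y :* z) := (con 1ℚ :+ x) :- y :* z) refl

  T-zero : ∀ n → T 0 (suc n) ≡ 1ℚ
  T-zero n = trans (cong (1ℚ ℚ.+_) (∑ℚ-zeros n _ (λ j → t-vanish 0 (suc j) (s≤s z≤n)))) (ℚP.+-identityʳ 1ℚ)

  -- Since C(a,k) = 0 for k > a, the partial sums stabilise from n = a on.
  T-stable : ∀ a n → a ≤ n → T a (suc n) ≡ T a (suc a)
  T-stable a n a≤n = trans (cong (T a ∘ suc) (sym (m+[n∸m]≡n a≤n)))
                           (∑ℚ-tail (suc a) (n ∸ a) (t a) (λ j → t-vanish a (suc a + j) (s≤s (m≤m+n a j))))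

  T-binomial : ∀ a → T a (suc a) ≡ (1ℚ ℚ.- q) ^ℚ a
  T-binomial zero    = ℚP.+-identityʳ 1ℚ
  T-binomial (suc a) = begin
    T (suc a) (suc (suc a))             ≡⟨ T-pascal a (suc a) ⟩
    T a (suc (suc a)) ℚ.- q ℚ.* T a (suc a) ≡⟨ cong (ℚ._- q ℚ.* T a (suc a)) (T-stable a (suc a) (n≤1+n a)) ⟩
    T a (suc a) ℚ.- q ℚ.* T a (suc a)   ≡⟨ factor (T a (suc a)) q ⟩
    (1ℚ ℚ.- q) ℚ.* T a (suc a)          ≡⟨ cong ((1ℚ ℚ.- q) ℚ.*_) (T-binomial a) ⟩
    (1ℚ ℚ.- q) ^ℚ suc a                 ∎
    where
    open ≡-Reasoning
    open +-*-Solver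
    factor : ∀ x y → x ℚ.- y ℚ.* x ≡ (1ℚ ℚ.- y) ℚ.* x
    factor = solve 2 (λ x y → x :- y :* x := (con 1ℚ :- y) :* x) refl

  H-closed : ∀ a n → H (suc a) (suc n) ≡ (1ℚ ℚ.- q) ℚ.* T a (suc n)
  H-closed zero n = begin
    1ℚ ℚ.- q ℚ.* 1ℚ           ≡⟨ factor q ⟩
    (1ℚ ℚ.- q) ℚ.* 1ℚ         ≡⟨ cong ((1ℚ ℚ.- q) ℚ.*_) (T-zero n) ⟨
    (1ℚ ℚ.- q) ℚ.* T 0 (suc n) ∎
    where
    open ≡-Reasoning
    open +-*-Solver
    factor : ∀ q → 1ℚ ℚ.- q ℚ.* 1ℚ ≡ (1ℚ ℚ.- q) ℚ.* 1ℚ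
    factor = solve 1 (λ q → con 1ℚ :- q :* con 1ℚ := (con 1ℚ :- q) :* con 1ℚ) refl
  H-closed (suc a) zero = begin
    H (suc a) 1 ℚ.- q ℚ.* 0ℚ   ≡⟨ cancel (H (suc a) 1) q ⟩
    H (suc a) 1                ≡⟨ H-closed a zero ⟩
    (1ℚ ℚ.- q) ℚ.* T (suc a) 1 ∎
    where
    open ≡-Reasoning
    open +-*-Solver
    cancel : ∀ x q → x ℚ.- q ℚ.* 0ℚ ≡ x
    cancel = solve 2 (λ x q → x :- q :* con 0ℚ := x) refl
  H-closed (suc a) (suc n) = begin
    H (suc a) (suc (suc n)) ℚ.- q ℚ.* H (suc a) (suc n)
      ≡⟨ cong₂ (λ u v → u ℚ.- q ℚ.* v) (H-closed a (suc n)) (H-closed a n) ⟩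
    (1ℚ ℚ.- q) ℚ.* T a (suc (suc n)) ℚ.- q ℚ.* ((1ℚ ℚ.- q) ℚ.* T a (suc n))
      ≡⟨ factor q (T a (suc (suc n))) (T a (suc n)) ⟩
    (1ℚ ℚ.- q) ℚ.* (T a (suc (suc n)) ℚ.- q ℚ.* T a (suc n))
      ≡⟨ cong ((1ℚ ℚ.- q) ℚ.*_) (T-pascal a (suc n)) ⟨
    (1ℚ ℚ.- q) ℚ.* T (suc a) (suc (suc n)) ∎
    where
    open ≡-Reasoning
    open +-*-Solver
    factor : ∀ q x y → (1ℚ ℚ.- q) ℚ.* x ℚ.- q ℚ.* ((1ℚ ℚ.- q) ℚ.* y) ≡ (1ℚ ℚ.- q) ℚ.* (x ℚ.- q ℚ.* y)
    factor = solve 3 (λ q x y → (con 1ℚ :- q) :* x :- q :* ((con 1ℚ :- q) :* y) := (con 1ℚ :- q) :* (x :- q :* y)) refl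

module Proportions (m : ℕ) (pr : Prime (suc m)) where

  open Counting m pr
  open Density m

  N-density : ∀ n A → Unique A → (ℤ.+ N n A / 1) ℚ.* q ^ℚ n ≡ H (length A) n
  N-density n [] _ = begin
    (ℤ.+ N n [] / 1) ℚ.* q ^ℚ n                      ≡⟨ cong₂ (λ k r → (ℤ.+ k / 1) ℚ.* r) (N-[] n) (sym (1/p^≡q^ n)) ⟩
    (ℤ.+ p ^ n / 1) ℚ.* _/_ (ℤ.+ 1) (p ^ n) {{m^n≢0 p n}} ≡⟨ n*1/n≡1 (p ^ n) {{m^n≢0 p n}} ⟩
    1ℚ                                               ∎
    where open ≡-Reasoning
  N-density zero    (x ∷ A) _ rewrite N-zero x A = ℚP.*-zeroˡ 1ℚ
  N-density (suc n) (x ∷ A) (x∉A ∷ A-unique) = begin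
    a ℚ.* (q ℚ.* q ^ℚ n)                         ≡⟨ unfold a b q (q ^ℚ n) ⟩
    (a ℚ.+ b) ℚ.* q ^ℚ suc n ℚ.- q ℚ.* (b ℚ.* q ^ℚ n)
      ≡⟨ cong (λ c → c ℚ.* q ^ℚ suc n ℚ.- q ℚ.* (b ℚ.* q ^ℚ n)) a+b≡c ⟩
    c ℚ.* q ^ℚ suc n ℚ.- q ℚ.* (b ℚ.* q ^ℚ n)
      ≡⟨ cong₂ (λ u v → u ℚ.- q ℚ.* v) (N-density (suc n) A A-unique) (N-density n A A-unique) ⟩
    H (length A) (suc n) ℚ.- q ℚ.* H (length A) n ∎
    where
    open ≡-Reasoning
    open +-*-Solver
    a b c : ℚ
    a = ℤ.+ N (suc n) (x ∷ A) / 1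
    b = ℤ.+ N n A / 1
    c = ℤ.+ N (suc n) A / 1
    a+b≡c : a ℚ.+ b ≡ c
    a+b≡c = trans (sym (/1-+ (ℤ.+ N (suc n) (x ∷ A)) (ℤ.+ N n A))) (cong (λ k → ℤ.+ k / 1) (N-delete n x A x∉A))
    unfold : ∀ a b q Q → a ℚ.* (q ℚ.* Q) ≡ (a ℚ.+ b) ℚ.* (q ℚ.* Q) ℚ.- q ℚ.* (b ℚ.* Q)
    unfold = solve 4 (λ a b q Q → a :* (q :* Q) := (a :+ b) :* (q :* Q) :- q :* (b :* Q)) refl

  D-closed : ∀ d → D d p pr ≡ (1ℚ ℚ.- q) ℚ.* T m (suc d)
  D-closed d = begin
    D d p pr                                             ≡⟨ /-as-* (ℤ.+ M d p) (p ^ suc d) {{m^n≢0 p (suc d)}} ⟩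
    (ℤ.+ M d p / 1) ℚ.* _/_ (ℤ.+ 1) (p ^ suc d) {{m^n≢0 p (suc d)}}
      ≡⟨ cong₂ (λ k r → (ℤ.+ k / 1) ℚ.* r) (M≡N d) (1/p^≡q^ (suc d)) ⟩
    (ℤ.+ N (suc d) (allFin p) / 1) ℚ.* q ^ℚ suc d        ≡⟨ N-density (suc d) (allFin p) (allFin⁺ p) ⟩
    H (length (allFin p)) (suc d)                        ≡⟨ cong (λ a → H a (suc d)) (length-tabulate {n = p} id) ⟩
    H p (suc d)                                          ≡⟨ H-closed m d ⟩
    (1ℚ ℚ.- q) ℚ.* T m (suc d)                           ∎
    where open ≡-Reasoning

  -- The right-hand side RHS is the same expression, with the sum cut off
  -- at min(d, p - 1) where it has already stabilised.
  RHS-closed : ∀ d → RHS d p pr ≡ (1ℚ ℚ.- q) ℚ.* T m (suc d)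
  RHS-closed d = cong ((1ℚ ℚ.- q) ℚ.*_) (trans (foldr-applyUpTo (suc (d ⊓ m)) (t m) id) (cut-off d))
    where
    cut-off : ∀ d → T m (suc (d ⊓ m)) ≡ T m (suc d)
    cut-off d with ≤-total d m
    ... | inj₁ d≤m = cong (T m ∘ suc) (m≤n⇒m⊓n≡m d≤m)
    ... | inj₂ m≤d = trans (cong (T m ∘ suc) (m≥n⇒m⊓n≡n m≤d)) (sym (T-stable m d m≤d))

proposition1 : (p d : ℕ) → (pr : Prime p) → 1 ≤ d →
    (D d p pr ≡ RHS d p pr) × (p ≤ d + 1 → D d p pr ≡ RHS' p pr)
proposition1 zero    d pr _ = ⊥-elim (≢-nonZero⁻¹ 0 {{prime⇒nonZero pr}} refl)
proposition1 (suc m) d pr _ = trans (D-closed d) (sym (RHS-closed d)) , complete-sum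
  where
  open Proportions m pr
  open Density m using (q; T-stable; T-binomial)
  -- For p ≤ d + 1 the sum is complete, so it is (1 - 1/p)^(p-1).
  complete-sum : suc m ≤ d + 1 → D d (suc m) pr ≡ RHS' (suc m) pr
  complete-sum p≤d+1 = trans (D-closed d) (cong ((1ℚ ℚ.- q) ℚ.*_) (trans (T-stable m d m≤d) (T-binomial m)))
    where
    m≤d : m ≤ d
    m≤d = ≤-pred (subst (suc m ≤_) (+-comm d 1) p≤d+1)
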